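{- Let $n\ge1$, $1\le i\le n$, $m\ge1$, $A=(a_{p,q})\in B^{i,m}$, $1\le s<i$ and $1\le r\le\ell^A(s)$. Then $$\sum_{p=r^A(s,r)}^n x^A(s,p)=S^A(s,r^A(s,r))-S^A(s,n)+a_{s+1,n}.$$
   Context: $B^{i,m}$ is the set of arrays $A=(a_{p,q})$ of non-negative integers indexed by $1\le p\le i$, $i\le q\le n$, with $\sum_{r=1}^n a_{\beta(r)}\le m$ for every Dyck path $\beta$ (a sequence of positions $\beta(1)=(1,i),\dots,\beta(n)=(i,n)$ with $\beta(r+1)\in\{(a,b+1),(a+1,b)\}$ if $\beta(r)=(a,b)$); $a_{p,q}=0$ outside this range. For $1\le s<i\le r\le n$, the step path $p_{s,r}$ is the set of positions $(s,i),(s,i+1),\dots,(s,r),(s+1,r),(s+1,r+1),\dots,(s+1,n)$; $S^A(s,r)=\sum_{x\in p_{s,r}}a_x$ and $M^A(s)=\max\{S^A(s,r):i\le r\le n\}$. Define $r^A(s,0)=i-1$ and recursively $r^A(s,k+1)=\max\{r>r^A(s,k): S^A(s,r)=\max\{S^A(s,p):r^A(s,k)<p\le n\}\}$, and let $\ell^A(s)$ be the index with $r^A(s,\ell^A(s))=n$. Define integers $x^A(s,r)$, $i\le r\le n$: $x^A(s,r)=0$ if $r\notin\{r^A(s,1),\dots,r^A(s,\ell^A(s))\}$; $x^A(s,n)=a_{s+1,n}$; and for $1\le k<\ell^A(s)$, $x^A(s,r^A(s,k))$ is determined recursively by $S^A(s,r^A(s,k+1))+\sum_{p=i}^{r^A(s,k)}x^A(s,p)=M^A(s)$.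 -}

module Defs where

open import Data.Nat using (ℕ; zero; suc; _+_; _∸_; _≤_; _<_; _⊔_; _≤ᵇ_; _<ᵇ_)
open import Data.Integer as ℤ using (ℤ)
open import Data.Product using (_×_; _,_)
open import Data.Sum using (_⊎_)
open import Data.Bool using (if_then_else_)
open import Relation.Binary.PropositionalEquality using (_≡_)

-- Arrays A = (a_{p,q}) are represented as functions ℕ → ℕ → ℕ (A p q = a_{p,q}).

sumFrom : (ℕ → ℕ) → ℕ → ℕ → ℕ
sumFrom f a zero    = 0
sumFrom f a (suc k) = f a + sumFrom f (suc a) k

-- Σ_{q=a}^{b} f q   (empty, i.e. 0, when b < a)
sumRange : (ℕ → ℕ) → ℕ → ℕ → ℕ
sumRange f a b = sumFrom f a (suc b ∸ a)

sumFromℤ : (ℕ → ℤ) → ℕ → ℕ → ℤ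
sumFromℤ f a zero    = ℤ.+ 0
sumFromℤ f a (suc k) = f a ℤ.+ sumFromℤ f (suc a) k

sumRangeℤ : (ℕ → ℤ) → ℕ → ℕ → ℤ
sumRangeℤ f a b = sumFromℤ f a (suc b ∸ a)

maxOver : (ℕ → ℕ) → ℕ → ℕ → ℕ
maxOver f a zero    = f a
maxOver f a (suc k) = f (a + suc k) ⊔ maxOver f a k

maxRange : (ℕ → ℕ) → ℕ → ℕ → ℕ
maxRange f a b = maxOver f a (b ∸ a)

-- lastArgOver f a k = the largest q ∈ [a, a+k] with f q = maxOver f a k
lastArgOver : (ℕ → ℕ) → ℕ → ℕ → ℕ
lastArgOver f a zero    = a
lastArgOver f a (suc k) =
  if maxOver f a k ≤ᵇ f (a + suc k) then a + suc k else lastArgOver f a k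

lastArgmax : (ℕ → ℕ) → ℕ → ℕ → ℕ
lastArgmax f a b = lastArgOver f a (b ∸ a)

Step : ℕ × ℕ → ℕ × ℕ → Set
Step (a , b) c = (c ≡ (a , suc b)) ⊎ (c ≡ (suc a , b))

IsDyckPath : (n i : ℕ) → (ℕ → ℕ × ℕ) → Set
IsDyckPath n i β =
  (β 1 ≡ (1 , i)) × (β n ≡ (i , n)) ×
  (∀ r → 1 ≤ r → r < n → Step (β r) (β (suc r)))

entry : (ℕ → ℕ → ℕ) → ℕ × ℕ → ℕ
entry A (p , q) = A p q

Supported : (n i : ℕ) → (ℕ → ℕ → ℕ) → Set
Supported n i A = ∀ p q → ¬InRange p q → A p q ≡ 0
  where
  ¬InRange : ℕ → ℕ → Set
  ¬InRange p q = (p ≡ 0) ⊎ (i < p) ⊎ (q < i) ⊎ (n < q)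

InB : (n i m : ℕ) → (ℕ → ℕ → ℕ) → Set
InB n i m A =
  Supported n i A ×
  (∀ β → IsDyckPath n i β → sumRange (λ r → entry A (β r)) 1 n ≤ m)

-- S^A(s,r) = Σ_{q=i}^{r} a_{s,q} + Σ_{q=r}^{n} a_{s+1,q}   (sum over the step path p_{s,r})
S : (n i : ℕ) → (ℕ → ℕ → ℕ) → ℕ → ℕ → ℕ
S n i A s r = sumRange (A s) i r + sumRange (A (suc s)) r n

M : (n i : ℕ) → (ℕ → ℕ → ℕ) → ℕ → ℕ
M n i A s = maxRange (S n i A s) i n

-- r^A(s,k): r(s,0) = i-1,
-- r(s,k+1) = max { r > r(s,k) : S(s,r) = max { S(s,p) : r(s,k) < p ≤ n } }.
-- (Once r(s,k) = n the paper's sequence stops; here it is continued constantly by n.)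
rSeq : (n i : ℕ) → (ℕ → ℕ → ℕ) → ℕ → ℕ → ℕ
rSeq n i A s zero    = i ∸ 1
rSeq n i A s (suc k) =
  if rSeq n i A s k <ᵇ n
  then lastArgmax (S n i A s) (suc (rSeq n i A s k)) n
  else n

-- Write P c = Σ_{p=i}^{c-1} x p.  The defining equations of x say
-- S(r_{k+1}) + P(r_k + 1) = M for 1 ≤ k < ℓ, and this also holds for k = 0
-- because r_1 is an argmax of S on [i, n] and P i = 0.  Since x vanishes
-- strictly between consecutive r_k, P(r_{k+1}) = P(r_k + 1), hence the
-- potential S(r_k) + P(r_k) equals M for all 1 ≤ k ≤ ℓ.  Subtracting this
-- identity at k from the one at ℓ (where r_ℓ = n) gives the claim, as the
-- tail sum Σ_{p=r_k}^n x p equals P n + x n - P(r_k).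
{-# OPTIONS --safe #-}
module Submission where

open import Defs
open import Data.Nat using (ℕ; suc; _≤_; _<_)
open import Data.Integer using (ℤ; +_; _+_; _-_)
open import Relation.Binary.PropositionalEquality using (_≡_; _≢_)

open import Data.Bool using (true; false)
open import Data.Bool.Properties using (T-≡)
open import Data.Integer using (0ℤ)
open import Data.Integer.Properties using (+-assoc; +-identityˡ; +-identityʳ)
open import Data.Integer.Tactic.RingSolver using (solve)
open import Data.List using ([]; _∷_)
open import Data.Nat using (zero; z≤n; s≤s; _∸_; _≤ᵇ_; _≤?_)
  renaming (_+_ to _+ℕ_)
open import Data.Nat.Properties
  using ( ≤-refl; ≤-trans; <⇒≤; <-≤-trans; <-irrefl; ≰⇒>; ≰⇒≥
        ; m≤m+n; m<m+n; n≤1+n; m≤n+m∸n; m≤n⇒m<n∨m≡n; +-suc; +-comm; +-∸-assoc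
        ; m+[n∸m]≡n; m∸n+n≡m; m+n∸n≡m; n∸n≡0; <⇒<ᵇ; ≤ᵇ-reflects-≤; m≥n⇒m⊔n≡m; m≤n⇒m⊔n≡n )
  renaming (+-identityʳ to ℕ-+-identityʳ)
open import Data.Sum using (inj₁; inj₂)
open import Function.Bundles using (Equivalence)
open import Relation.Binary.PropositionalEquality
  using (refl; sym; trans; cong; cong₂; subst; module ≡-Reasoning)
open import Relation.Nullary using (yes; no; ofʸ; ofⁿ)

open ≡-Reasoning

lastArgOver-≥ : ∀ f a k → a ≤ lastArgOver f a k
lastArgOver-≥ f a zero = ≤-refl
lastArgOver-≥ f a (suc k) with maxOver f a k ≤ᵇ f (a +ℕ suc k)
... | true  = m≤m+n a (suc k)
... | false = lastArgOver-≥ f a k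

lastArgOver-maximises : ∀ f a k → f (lastArgOver f a k) ≡ maxOver f a k
lastArgOver-maximises f a zero = refl
lastArgOver-maximises f a (suc k)
  with maxOver f a k ≤ᵇ f (a +ℕ suc k) | ≤ᵇ-reflects-≤ (maxOver f a k) (f (a +ℕ suc k))
... | true  | ofʸ max≤new = sym (m≥n⇒m⊔n≡m max≤new)
... | false | ofⁿ max≰new =
  trans (lastArgOver-maximises f a k) (sym (m≤n⇒m⊔n≡n (≰⇒≥ max≰new)))

sumFromℤ-+ : ∀ g a j k → sumFromℤ g a (j +ℕ k) ≡ sumFromℤ g a j + sumFromℤ g (a +ℕ j) k
sumFromℤ-+ g a zero k rewrite ℕ-+-identityʳ a = sym (+-identityˡ _)
sumFromℤ-+ g a (suc j) k rewrite +-suc a j =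
  trans (cong (λ t → g a + t) (sumFromℤ-+ g (suc a) j k)) (sym (+-assoc (g a) _ _))

sumFromℤ-split : ∀ g {a c d} → a ≤ c → c ≤ d →
  sumFromℤ g a (d ∸ a) ≡ sumFromℤ g a (c ∸ a) + sumFromℤ g c (d ∸ c)
sumFromℤ-split g {a} {c} {d} a≤c c≤d = begin
  sumFromℤ g a (d ∸ a)                                       ≡⟨ cong (sumFromℤ g a) lengths ⟩
  sumFromℤ g a ((c ∸ a) +ℕ (d ∸ c))                          ≡⟨ sumFromℤ-+ g a (c ∸ a) (d ∸ c) ⟩
  sumFromℤ g a (c ∸ a) + sumFromℤ g (a +ℕ (c ∸ a)) (d ∸ c)   ≡⟨ cong (λ b → sumFromℤ g a (c ∸ a) + sumFromℤ g b (d ∸ c)) (m+[n∸m]≡n a≤c) ⟩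
  sumFromℤ g a (c ∸ a) + sumFromℤ g c (d ∸ c)                ∎
  where
  lengths : d ∸ a ≡ (c ∸ a) +ℕ (d ∸ c)
  lengths = begin
    d ∸ a                ≡⟨ cong (_∸ a) (sym (m∸n+n≡m c≤d)) ⟩
    (d ∸ c) +ℕ c ∸ a     ≡⟨ +-∸-assoc (d ∸ c) a≤c ⟩
    (d ∸ c) +ℕ (c ∸ a)   ≡⟨ +-comm (d ∸ c) (c ∸ a) ⟩
    (c ∸ a) +ℕ (d ∸ c)   ∎

sumFromℤ-vanishing : ∀ g a k → (∀ p → a ≤ p → p < a +ℕ k → g p ≡ 0ℤ) → sumFromℤ g a k ≡ 0ℤ
sumFromℤ-vanishing g a zero g≡0 = refl
sumFromℤ-vanishing g a (suc k) g≡0 =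
  cong₂ _+_ (g≡0 a ≤-refl (m<m+n a (s≤s z≤n)))
            (sumFromℤ-vanishing g (suc a) k λ p a<p p<a+k →
               g≡0 p (<⇒≤ a<p) (subst (p <_) (sym (+-suc a k)) p<a+k))

sumFromℤ-prefix-+-sumRangeℤ : ∀ g {a c b} → a ≤ c → c ≤ b →
  sumFromℤ g a (c ∸ a) + sumRangeℤ g c b ≡ sumFromℤ g a (b ∸ a) + g b
sumFromℤ-prefix-+-sumRangeℤ g {a} {c} {b} a≤c c≤b = begin
  sumFromℤ g a (c ∸ a) + sumRangeℤ g c b                ≡⟨ sym (sumFromℤ-split g a≤c (≤-trans c≤b (n≤1+n b))) ⟩
  sumFromℤ g a (suc b ∸ a)                              ≡⟨ sumFromℤ-split g (≤-trans a≤c c≤b) (n≤1+n b) ⟩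
  sumFromℤ g a (b ∸ a) + sumFromℤ g b (suc b ∸ b)       ≡⟨ cong (λ k → sumFromℤ g a (b ∸ a) + sumFromℤ g b k) (m+n∸n≡m 1 b) ⟩
  sumFromℤ g a (b ∸ a) + (g b + 0ℤ)                     ≡⟨ cong (λ t → sumFromℤ g a (b ∸ a) + t) (+-identityʳ (g b)) ⟩
  sumFromℤ g a (b ∸ a) + g b                            ∎

potential-difference : ∀ {M} Sʳ Pʳ Sⁿ Pⁿ X {G : ℤ} →
  Sʳ + Pʳ ≡ M → Sⁿ + Pⁿ ≡ M → Pʳ + G ≡ Pⁿ + X → G ≡ (Sʳ - Sⁿ) + X
potential-difference {M} Sʳ Pʳ Sⁿ Pⁿ X {G} eʳ eⁿ eᴳ = begin
  G                                                     ≡⟨ solve (M ∷ Pʳ ∷ G ∷ []) ⟩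
  (M - M) + ((Pʳ + G) - (Pʳ + G)) + G                   ≡⟨ cong₂ (λ u v → u + (v - (Pʳ + G)) + G) (cong₂ _-_ (sym eʳ) (sym eⁿ)) eᴳ ⟩
  ((Sʳ + Pʳ) - (Sⁿ + Pⁿ)) + ((Pⁿ + X) - (Pʳ + G)) + G   ≡⟨ solve (Sʳ ∷ Sⁿ ∷ Pʳ ∷ Pⁿ ∷ X ∷ G ∷ []) ⟩
  (Sʳ - Sⁿ) + X                                         ∎

module IncreasingUpTo {r : ℕ → ℕ} {ℓ : ℕ} (r-step : ∀ k → k < ℓ → r k < r (suc k)) where

  r-mono : ∀ {j k} → j ≤ k → k ≤ ℓ → r j ≤ r k
  r-mono {k = zero} z≤n _ = ≤-refl
  r-mono {j} {suc k} j≤1+k 1+k≤ℓ with m≤n⇒m<n∨m≡n j≤1+k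
  ... | inj₂ refl        = ≤-refl
  ... | inj₁ (s≤s j≤k)  = ≤-trans (r-mono j≤k (<⇒≤ 1+k≤ℓ)) (<⇒≤ (r-step k 1+k≤ℓ))

  r-skips-gap : ∀ {j k p} → k < ℓ → r k < p → p < r (suc k) → j ≤ ℓ → r j ≢ p
  r-skips-gap {j} {k} k<ℓ rk<p p<r1+k j≤ℓ refl with j ≤? k
  ... | yes j≤k = <-irrefl refl (<-≤-trans rk<p (r-mono j≤k (<⇒≤ k<ℓ)))
  ... | no  j≰k = <-irrefl refl (<-≤-trans p<r1+k (r-mono (≰⇒> j≰k) j≤ℓ))

module Breakpoints (n i : ℕ) (A : ℕ → ℕ → ℕ) (s ℓ : ℕ)
  (r-<n : ∀ k → k < ℓ → rSeq n i A s k < n) where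

  r : ℕ → ℕ
  r = rSeq n i A s

  f : ℕ → ℕ
  f = S n i A s

  rSeq-suc : ∀ k → k < ℓ → r (suc k) ≡ lastArgmax f (suc (r k)) n
  rSeq-suc k k<ℓ rewrite Equivalence.to T-≡ (<⇒<ᵇ (r-<n k k<ℓ)) = refl

  rSeq-step : ∀ k → k < ℓ → r k < r (suc k)
  rSeq-step k k<ℓ rewrite rSeq-suc k k<ℓ = lastArgOver-≥ f (suc (r k)) (n ∸ suc (r k))

  open IncreasingUpTo rSeq-step public

module Potential (n i : ℕ) (1≤i : 1 ≤ i) (A : ℕ → ℕ → ℕ) (s ℓ : ℕ)
  (r-ℓ : rSeq n i A s ℓ ≡ n) (r-<n : ∀ k → k < ℓ → rSeq n i A s k < n)
  (x : ℕ → ℤ)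
  (x-zero : ∀ p → i ≤ p → p ≤ n → (∀ k → 1 ≤ k → k ≤ ℓ → rSeq n i A s k ≢ p) → x p ≡ + 0)
  (x-defining : ∀ k → 1 ≤ k → k < ℓ →
    + S n i A s (rSeq n i A s (suc k)) + sumRangeℤ x i (rSeq n i A s k) ≡ + M n i A s)
  where

  open Breakpoints n i A s ℓ r-<n public

  P : ℕ → ℤ
  P c = sumFromℤ x i (c ∸ i)

  rSeq-≤n : ∀ {k} → k ≤ ℓ → r k ≤ n
  rSeq-≤n k≤ℓ = subst (_ ≤_) r-ℓ (r-mono k≤ℓ ≤-refl)

  i≤1+rSeq : ∀ {k} → k ≤ ℓ → i ≤ suc (r k)
  i≤1+rSeq k≤ℓ = ≤-trans (m≤n+m∸n i 1) (s≤s (r-mono z≤n k≤ℓ))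

  i≤rSeq : ∀ {k} → 1 ≤ k → k ≤ ℓ → i ≤ r k
  i≤rSeq {suc k} _ k<ℓ = ≤-trans (i≤1+rSeq (<⇒≤ k<ℓ)) (rSeq-step k k<ℓ)

  P-constant-in-gap : ∀ k → k < ℓ → P (r (suc k)) ≡ P (suc (r k))
  P-constant-in-gap k k<ℓ = begin
    P (r (suc k))                                                    ≡⟨ sumFromℤ-split x i≤1+rk (rSeq-step k k<ℓ) ⟩
    P (suc (r k)) + sumFromℤ x (suc (r k)) (r (suc k) ∸ suc (r k))   ≡⟨ cong (λ t → P (suc (r k)) + t) gap-sum ⟩
    P (suc (r k)) + 0ℤ                                               ≡⟨ +-identityʳ _ ⟩
    P (suc (r k))                                                    ∎
    where
    i≤1+rk : i ≤ suc (r k)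
    i≤1+rk = i≤1+rSeq (<⇒≤ k<ℓ)

    gap-sum : sumFromℤ x (suc (r k)) (r (suc k) ∸ suc (r k)) ≡ 0ℤ
    gap-sum = sumFromℤ-vanishing x (suc (r k)) (r (suc k) ∸ suc (r k)) λ p rk<p p<gap-end →
      let p<r1+k = subst (p <_) (m+[n∸m]≡n (rSeq-step k k<ℓ)) p<gap-end in
      x-zero p (≤-trans i≤1+rk rk<p) (≤-trans (<⇒≤ p<r1+k) (rSeq-≤n k<ℓ))
        λ j _ j≤ℓ → r-skips-gap k<ℓ rk<p p<r1+k j≤ℓ

  potential-before : ∀ k → k < ℓ → + f (r (suc k)) + P (suc (r k)) ≡ + M n i A s
  potential-before zero 0<ℓ rewrite rSeq-suc 0 0<ℓ | m+[n∸m]≡n 1≤i | n∸n≡0 i =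
    trans (+-identityʳ _) (cong +_ (lastArgOver-maximises f i (n ∸ i)))
  potential-before (suc k) k<ℓ = x-defining (suc k) (s≤s z≤n) k<ℓ

  potential : ∀ k → 1 ≤ k → k ≤ ℓ → + f (r k) + P (r k) ≡ + M n i A s
  potential (suc k) _ k<ℓ =
    trans (cong (λ t → + f (r (suc k)) + t) (P-constant-in-gap k k<ℓ)) (potential-before k k<ℓ)

proposition2p4 :
    (n i m : ℕ) → 1 ≤ n → 1 ≤ i → i ≤ n → 1 ≤ m →
    (A : ℕ → ℕ → ℕ) → InB n i m A →
    (s : ℕ) → 1 ≤ s → s < i →
    -- ℓ = ℓ^A(s): the index with r^A(s,ℓ) = n
    (ℓ : ℕ) → rSeq n i A s ℓ ≡ n → (∀ k → k < ℓ → rSeq n i A s k < n) →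
    -- x = x^A(s,-), given by its defining equations on i ≤ p ≤ n
    (x : ℕ → ℤ) →
    (∀ p → i ≤ p → p ≤ n → (∀ k → 1 ≤ k → k ≤ ℓ → rSeq n i A s k ≢ p) → x p ≡ + 0) →
    x n ≡ + A (suc s) n →
    (∀ k → 1 ≤ k → k < ℓ →
      + S n i A s (rSeq n i A s (suc k)) + sumRangeℤ x i (rSeq n i A s k) ≡ + M n i A s) →
    (r : ℕ) → 1 ≤ r → r ≤ ℓ →
    sumRangeℤ x (rSeq n i A s r) n
      ≡ (+ S n i A s (rSeq n i A s r) - + S n i A s n) + + A (suc s) n
proposition2p4 n i _ _ 1≤i _ _ A _ s _ _ ℓ r-ℓ r-<n x x-zero x-n x-defining k 1≤k k≤ℓ = begin
  sumRangeℤ x (r k) n                   ≡⟨ potential-difference (+ f (r k)) (P (r k)) (+ f n) (P n) (x n)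
                                             (potential k 1≤k k≤ℓ) potential-n tail-sum ⟩
  (+ f (r k) - + f n) + x n             ≡⟨ cong (λ a → (+ f (r k) - + f n) + a) x-n ⟩
  (+ f (r k) - + f n) + + A (suc s) n   ∎
  where
  open Potential n i 1≤i A s ℓ r-ℓ r-<n x x-zero x-defining

  potential-n : + f n + P n ≡ + M n i A s
  potential-n = subst (λ c → + f c + P c ≡ + M n i A s) r-ℓ (potential ℓ (≤-trans 1≤k k≤ℓ) ≤-refl)

  tail-sum : P (r k) + sumRangeℤ x (r k) n ≡ P n + x n
  tail-sum = sumFromℤ-prefix-+-sumRangeℤ x (i≤rSeq 1≤k k≤ℓ) (rSeq-≤n k≤ℓ)
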